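{- Let $A_1,A_2$ be good $\lambda\alpha$-terms with $A_1\equiv_{\alpha}A_2$. If $A_1\twoheadrightarrow B_1$ and $A_2\twoheadrightarrow B_2$ in $\lambda\alpha$, then there are terms $C_1,C_2$ with $B_1\twoheadrightarrow C_1$, $B_2\twoheadrightarrow C_2$ in $\lambda\alpha$ and $C_1\equiv_{\alpha}C_2$.
   Context: Variables $x,y,z,\ldots$; $\mathsf{x},\mathsf{y},\mathsf{z}$ range over variables. Terms and substitutions of $\lambda\alpha$: $A,B::=\mathsf{x}\mid AB\mid\lambda\mathsf{x}.A\mid S\circ A$, $S::=[B/\mathsf{x}]\mid W\mathsf{x}\mid\{\mathsf{y}\mathsf{x}\}\mid S_{\mathsf{x}}$; $S_1\circ S_2\circ A$ means $S_1\circ(S_2\circ A)$, $S\circ AB$ means $S\circ(AB)$, $\lambda\mathsf{x}.S\circ A$ means $\lambda\mathsf{x}.(S\circ A)$. A context $\Gamma$ is a pair $G,L$ of a finite set $G$ of variables (global part) and a finite list $L$ of variables with repetitions allowed (local part); $\mathsf{x}\in\Gamma$ means $\mathsf{x}\in G$ or $\mathsf{x}$ occurs in $L$; $\Gamma,\mathsf{x}$ denotes $G,(L,\mathsf{x})$; a context with empty local part is written $G$. Derivable judgements $\Gamma\vdash A$, $\Gamma\vdash S\triangleright\Delta$ are given by: $G\vdash\mathsf{x}$ if $\mathsf{x}\in G$; $\Gamma,\mathsf{x}\vdash\mathsf{x}$; from $\Gamma\vdash\mathsf{x}$ infer $\Gamma,\mathsf{y}\vdash\mathsf{x}$ ($\mathsf{x}\neq\mathsf{y}$);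 from $\Gamma\vdash A$, $\Gamma\vdash B$ infer $\Gamma\vdash AB$; from $\Gamma,\mathsf{x}\vdash A$ infer $\Gamma\vdash\lambda\mathsf{x}.A$; from $\Gamma\vdash S\triangleright\Delta$, $\Delta\vdash A$ infer $\Gamma\vdash S\circ A$; from $\Gamma\vdash B$ infer $\Gamma\vdash[B/\mathsf{x}]\triangleright\Gamma,\mathsf{x}$; $\Gamma,\mathsf{x}\vdash W\mathsf{x}\triangleright\Gamma$; $\Gamma,\mathsf{y}\vdash\{\mathsf{y}\mathsf{x}\}\triangleright\Gamma,\mathsf{x}$; from $\Gamma\vdash S\triangleright\Delta$ infer $\Gamma,\mathsf{x}\vdash S_{\mathsf{x}}\triangleright\Delta,\mathsf{x}$. A term $A$ is good if $G\vdash A$ is derivable for some finite set $G$ (empty local part). Free variables: $FV(\mathsf{x})=\{\mathsf{x}\}$; $FV(AB)=FV(A)\sqcup FV(B)$; $FV(\lambda\mathsf{x}.A)=O_{\lambda\mathsf{x}}(FV(A))$; $FV(W\mathsf{x}\circ A)=FV(A),\mathsf{x}$; $FV([B/\mathsf{x}]\circ A)=FV((\lambda\mathsf{x}.A)B)$; $FV(\{\mathsf{y}\mathsf{x}\}\circ A)=FV(W\mathsf{y}\circ\lambda\mathsf{x}.A)$; $FV(S_{\mathsf{x}}\circ A)=FV(W\mathsf{x}\circ S\circ\lambda\mathsf{x}.A)$; with $O_{\lambda\mathsf{x}}(\Gamma,\mathsf{x})=\Gamma$, $O_{\lambda\mathsf{x}}(G)=G\setminus\{\mathsf{x}\}$,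 otherwise undefined, and $(\Gamma,\mathsf{x})\sqcup(\Delta,\mathsf{x})=(\Gamma\sqcup\Delta),\mathsf{x}$, $(\Gamma,\mathsf{x})\sqcup G=(\Gamma\sqcup(G\setminus\{\mathsf{x}\})),\mathsf{x}$, $G\sqcup(\Gamma,\mathsf{x})=((G\setminus\{\mathsf{x}\})\sqcup\Gamma),\mathsf{x}$, $G_1\sqcup G_2=G_1\cup G_2$, otherwise undefined. (For a good term, $FV(A)$ is defined and has empty local part, i.e. is a finite set.) Reduction of $\lambda\alpha$: one-step $\to$ is the closure under all constructors (under $\lambda\mathsf{x}.$, in either side of an application, in either component of $S\circ A$, inside $B$ of $[B/\mathsf{x}]$, inside $S$ of $S_{\mathsf{x}}$) of: $(\lambda\mathsf{x}.A)B\to[B/\mathsf{x}]\circ A$; $S\circ AB\to(S\circ A)(S\circ B)$; $S\circ\lambda\mathsf{x}.A\to\lambda\mathsf{x}.S_{\mathsf{x}}\circ A$; $[B/\mathsf{x}]\circ\mathsf{x}\to B$; $[B/\mathsf{x}]\circ W\mathsf{x}\circ A\to A$; $[B/\mathsf{x}]\circ\mathsf{z}\to\mathsf{z}$ ($\mathsf{x}\neq\mathsf{z}$); $\{\mathsf{y}\mathsf{x}\}\circ\mathsf{x}\to\mathsf{y}$; $\{\mathsf{y}\mathsf{x}\}\circ W\mathsf{x}\circ A\to W\mathsf{y}\circ A$; $\{\mathsf{y}\mathsf{x}\}\circ\mathsf{z}\to W\mathsf{y}\circ\mathsf{z}$ ($\mathsf{x}\neq\mathsf{z}$); $S_{\mathsf{x}}\circ\mathsf{x}\to\mathsf{x}$;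 $S_{\mathsf{x}}\circ W\mathsf{x}\circ A\to W\mathsf{x}\circ S\circ A$; $S_{\mathsf{x}}\circ\mathsf{z}\to W\mathsf{x}\circ S\circ\mathsf{z}$ ($\mathsf{x}\neq\mathsf{z}$); $W\mathsf{x}\circ\mathsf{z}\to\mathsf{z}$ ($\mathsf{x}\neq\mathsf{z}$); and ($\alpha$) $\lambda\mathsf{x}.A\to\lambda\mathsf{y}.\{\mathsf{y}\mathsf{x}\}\circ A$ provided $FV(\lambda\mathsf{x}.A)$ is defined, $\mathsf{x}\in FV(\lambda\mathsf{x}.A)$, $\mathsf{y}\notin FV(\lambda\mathsf{x}.A)$. $\twoheadrightarrow$ is the reflexive-transitive closure. Translation into $\lambda\upsilon'$-terms $a,b::=\mathsf{x}\mid\underline{1}\mid ab\mid\lambda a\mid a[s]$, $s::=b/\mid\,\uparrow\,\mid id\mid\,\Uparrow\! s$: inductively, $G\vdash\mathsf{x}\longrightarrow\mathsf{x}$ ($\mathsf{x}\in G$); $\Gamma,\mathsf{x}\vdash\mathsf{x}\longrightarrow\underline{1}$; $\Gamma\vdash\mathsf{x}\longrightarrow a$, $\mathsf{x}\neq\mathsf{y}$ give $\Gamma,\mathsf{y}\vdash\mathsf{x}\longrightarrow a[\uparrow]$; $\Gamma\vdash A\longrightarrow a$, $\Gamma\vdash B\longrightarrow b$ give $\Gamma\vdash AB\longrightarrow ab$; $\Gamma,\mathsf{x}\vdash A\longrightarrow a$ gives $\Gamma\vdash\lambda\mathsf{x}.A\longrightarrow\lambda a$; $\Gamma\vdash S\triangleright\Delta\longrightarrow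 s$, $\Delta\vdash A\longrightarrow a$ give $\Gamma\vdash S\circ A\longrightarrow a[s]$; $\Gamma\vdash B\longrightarrow b$ gives $\Gamma\vdash[B/\mathsf{x}]\triangleright\Gamma,\mathsf{x}\longrightarrow b/$; $\Gamma,\mathsf{x}\vdash W\mathsf{x}\triangleright\Gamma\longrightarrow\,\uparrow$; $\Gamma,\mathsf{y}\vdash\{\mathsf{y}\mathsf{x}\}\triangleright\Gamma,\mathsf{x}\longrightarrow id$; $\Gamma\vdash S\triangleright\Delta\longrightarrow s$ gives $\Gamma,\mathsf{x}\vdash S_{\mathsf{x}}\triangleright\Delta,\mathsf{x}\longrightarrow\,\Uparrow\! s$. $A\equiv_{\Gamma}B$ iff $\Gamma\vdash A\longrightarrow a$ and $\Gamma\vdash B\longrightarrow a$ for some $a$. For good terms $A,B$, $A\equiv_{\alpha}B$ iff $A\equiv_{G}B$ where $G$ is the set $FV(A)\cup FV(B)$. -}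

module Defs where

open import Data.Nat using (ℕ; _≟_)
open import Data.List using (List; []; _∷_; _++_)
open import Data.List.Membership.Propositional using (_∈_)
open import Data.Maybe using (Maybe; just; nothing; _>>=_)
open import Data.Product using (∃; ∃-syntax; _×_)
open import Data.Sum using (_⊎_)
open import Relation.Nullary using (¬_; yes; no)
open import Relation.Binary.PropositionalEquality using (_≡_; _≢_)
open import Relation.Binary.Construct.Closure.ReflexiveTransitive using (Star)

Var : Set
Var = ℕ

mutual
  data Tm : Set where
    var : Var → Tm
    app : Tm → Tm → Tm
    lam : Var → Tm → Tm
    sub : Sub → Tm → Tm            -- S ∘ A

  data Sub : Set where
    ext  : Tm → Var → Sub          -- [B/x]   (ext B x)
    W    : Var → Sub
    ren  : Var → Var → Sub         -- {y x}   (ren y x)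
    lift : Sub → Var → Sub         -- S_x     (lift S x)

-- Contexts: a finite set G of variables (global part, represented by a
-- list, used only up to membership) followed by a list of local variables.

infixl 5 _,,_
data Ctx : Set where
  glob : List Var → Ctx
  _,,_ : Ctx → Var → Ctx

_∈ᶜ_ : Var → Ctx → Set
x ∈ᶜ glob G   = x ∈ G
x ∈ᶜ (Γ ,, y) = x ≡ y ⊎ x ∈ᶜ Γ

mutual
  data _⊢_ : Ctx → Tm → Set where
    tGlob  : ∀ {G x} → x ∈ G → glob G ⊢ var x
    tHere  : ∀ {Γ x} → (Γ ,, x) ⊢ var x
    tThere : ∀ {Γ x y} → x ≢ y → Γ ⊢ var x → (Γ ,, y) ⊢ var x
    tApp   : ∀ {Γ A B} → Γ ⊢ A → Γ ⊢ B → Γ ⊢ app A B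
    tLam   : ∀ {Γ x A} → (Γ ,, x) ⊢ A → Γ ⊢ lam x A
    tSub   : ∀ {Γ Δ S A} → Γ ⊢ S ▷ Δ → Δ ⊢ A → Γ ⊢ sub S A

  data _⊢_▷_ : Ctx → Sub → Ctx → Set where
    tExt  : ∀ {Γ B x} → Γ ⊢ B → Γ ⊢ ext B x ▷ (Γ ,, x)
    tW    : ∀ {Γ x} → (Γ ,, x) ⊢ W x ▷ Γ
    tRen  : ∀ {Γ x y} → (Γ ,, y) ⊢ ren y x ▷ (Γ ,, x)
    tLift : ∀ {Γ Δ S x} → Γ ⊢ S ▷ Δ → (Γ ,, x) ⊢ lift S x ▷ (Δ ,, x)

Good : Tm → Set
Good A = ∃[ G ] (glob G ⊢ A)

remove : Var → List Var → List Var
remove x [] = []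
remove x (z ∷ G) with x ≟ z
... | yes _ = remove x G
... | no  _ = z ∷ remove x G

-- O_{λx}
Oλ : Var → Ctx → Maybe Ctx
Oλ x (glob G) = just (glob (remove x G))
Oλ x (Γ ,, y) with x ≟ y
... | yes _ = just Γ
... | no  _ = nothing

⊔G : List Var → Ctx → Maybe Ctx
⊔G G (glob H) = just (glob (G ++ H))
⊔G G (Δ ,, x) = ⊔G (remove x G) Δ >>= λ Θ → just (Θ ,, x)

G⊔ : Ctx → List Var → Maybe Ctx
G⊔ (glob H) G = just (glob (H ++ G))
G⊔ (Γ ,, x) G = G⊔ Γ (remove x G) >>= λ Θ → just (Θ ,, x)

_⊔_ : Ctx → Ctx → Maybe Ctx
glob G ⊔ Δ = ⊔G G Δ
(Γ ,, x) ⊔ glob G = G⊔ (Γ ,, x) G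
(Γ ,, x) ⊔ (Δ ,, y) with x ≟ y
... | yes _ = (Γ ⊔ Δ) >>= λ Θ → just (Θ ,, x)
... | no  _ = nothing

mutual
  FV : Tm → Maybe Ctx
  FV (var x)   = just (glob (x ∷ []))
  FV (app A B) = FV A >>= λ Γ → FV B >>= λ Δ → Γ ⊔ Δ
  FV (lam x A) = FV A >>= Oλ x
  FV (sub S A) = FV A >>= FVˢ S

  -- FVˢ S Φ computes FV(S ∘ A) from Φ = FV(A); this is exactly what the
  -- clauses for FV(S ∘ A) unfold to:
  --   FV(W x ∘ A)     = FV(A), x
  --   FV([B/x] ∘ A)   = FV((λx.A)B) = O_{λx}(FV A) ⊔ FV B
  --   FV({y x} ∘ A)   = FV(W y ∘ λx.A) = O_{λx}(FV A), y
  --   FV(S_x ∘ A)     = FV(W x ∘ S ∘ λx.A) = FV(S ∘ λx.A), x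
  FVˢ : Sub → Ctx → Maybe Ctx
  FVˢ (W x) Φ      = just (Φ ,, x)
  FVˢ (ext B x) Φ  = Oλ x Φ >>= λ Γ → FV B >>= λ Δ → Γ ⊔ Δ
  FVˢ (ren y x) Φ  = Oλ x Φ >>= λ Γ → just (Γ ,, y)
  FVˢ (lift S x) Φ = Oλ x Φ >>= FVˢ S >>= λ Γ → just (Γ ,, x)

infix 4 _⟶_ _⟶ˢ_ _↠_
mutual
  data _⟶_ : Tm → Tm → Set where
    beta      : ∀ {x A B} → app (lam x A) B ⟶ sub (ext B x) A
    sApp      : ∀ {S A B} → sub S (app A B) ⟶ app (sub S A) (sub S B)
    sLam      : ∀ {S x A} → sub S (lam x A) ⟶ lam x (sub (lift S x) A)
    extVar    : ∀ {B x} → sub (ext B x) (var x) ⟶ B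
    extW      : ∀ {B x A} → sub (ext B x) (sub (W x) A) ⟶ A
    extOther  : ∀ {B x z} → x ≢ z → sub (ext B x) (var z) ⟶ var z
    renVar    : ∀ {y x} → sub (ren y x) (var x) ⟶ var y
    renW      : ∀ {y x A} → sub (ren y x) (sub (W x) A) ⟶ sub (W y) A
    renOther  : ∀ {y x z} → x ≢ z → sub (ren y x) (var z) ⟶ sub (W y) (var z)
    liftVar   : ∀ {S x} → sub (lift S x) (var x) ⟶ var x
    liftW     : ∀ {S x A} → sub (lift S x) (sub (W x) A) ⟶ sub (W x) (sub S A)
    liftOther : ∀ {S x z} → x ≢ z → sub (lift S x) (var z) ⟶ sub (W x) (sub S (var z))
    wOther    : ∀ {x z} → x ≢ z → sub (W x) (var z) ⟶ var z
    alpha     : ∀ {x y A Γ} → FV (lam x A) ≡ just Γ → x ∈ᶜ Γ → ¬ (y ∈ᶜ Γ) →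
                lam x A ⟶ lam y (sub (ren y x) A)
    appL  : ∀ {A A' B} → A ⟶ A' → app A B ⟶ app A' B
    appR  : ∀ {A B B'} → B ⟶ B' → app A B ⟶ app A B'
    lamC  : ∀ {x A A'} → A ⟶ A' → lam x A ⟶ lam x A'
    subS  : ∀ {S S' A} → S ⟶ˢ S' → sub S A ⟶ sub S' A
    subT  : ∀ {S A A'} → A ⟶ A' → sub S A ⟶ sub S A'

  data _⟶ˢ_ : Sub → Sub → Set where
    extC  : ∀ {B B' x} → B ⟶ B' → ext B x ⟶ˢ ext B' x
    liftC : ∀ {S S' x} → S ⟶ˢ S' → lift S x ⟶ˢ lift S' x

_↠_ : Tm → Tm → Set
_↠_ = Star _⟶_

mutual
  data UTm : Set where
    uvar : Var → UTm
    one  : UTm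
    uapp : UTm → UTm → UTm
    ulam : UTm → UTm
    uclo : UTm → USub → UTm

  data USub : Set where
    slash : UTm → USub
    shift : USub
    uid   : USub
    ⇑_    : USub → USub

mutual
  data _⊩_⇝_ : Ctx → Tm → UTm → Set where
    rGlob  : ∀ {G x} → x ∈ G → glob G ⊩ var x ⇝ uvar x
    rHere  : ∀ {Γ x} → (Γ ,, x) ⊩ var x ⇝ one
    rThere : ∀ {Γ x y a} → Γ ⊩ var x ⇝ a → x ≢ y → (Γ ,, y) ⊩ var x ⇝ uclo a shift
    rApp   : ∀ {Γ A B a b} → Γ ⊩ A ⇝ a → Γ ⊩ B ⇝ b → Γ ⊩ app A B ⇝ uapp a b
    rLam   : ∀ {Γ x A a} → (Γ ,, x) ⊩ A ⇝ a → Γ ⊩ lam x A ⇝ ulam a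
    rSub   : ∀ {Γ Δ S A s a} → Γ ⊩ˢ S ▷ Δ ⇝ s → Δ ⊩ A ⇝ a → Γ ⊩ sub S A ⇝ uclo a s

  data _⊩ˢ_▷_⇝_ : Ctx → Sub → Ctx → USub → Set where
    rExt  : ∀ {Γ B x b} → Γ ⊩ B ⇝ b → Γ ⊩ˢ ext B x ▷ (Γ ,, x) ⇝ slash b
    rW    : ∀ {Γ x} → (Γ ,, x) ⊩ˢ W x ▷ Γ ⇝ shift
    rRen  : ∀ {Γ x y} → (Γ ,, y) ⊩ˢ ren y x ▷ (Γ ,, x) ⇝ uid
    rLift : ∀ {Γ Δ S x s} → Γ ⊩ˢ S ▷ Δ ⇝ s → (Γ ,, x) ⊩ˢ lift S x ▷ (Δ ,, x) ⇝ (⇑ s)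

_≡[_]_ : Tm → Ctx → Tm → Set
A ≡[ Γ ] B = ∃[ a ] (Γ ⊩ A ⇝ a × Γ ⊩ B ⇝ a)

-- α-equivalence of good terms: A ≡_G B with G = FV(A) ∪ FV(B)
-- (for good terms FV is defined with empty local part).
_≡α_ : Tm → Tm → Set
A ≡α B = Good A × Good B ×
  ∃[ GA ] ∃[ GB ] (FV A ≡ just (glob GA) × FV B ≡ just (glob GB) ×
                   A ≡[ glob (GA ++ GB) ] B)

-- Well-formed λα-terms are interpreted in Λ, de Bruijn terms whose binders
-- still carry a name: the interpretation replaces local variables by indices
-- and executes explicit substitutions.
-- The theorem joins the simulated reductions by confluence and reads the
-- common reduct back.

module Submission where

open import Defs
open import Data.Nat using (ℕ; zero; suc; _≟_)
open import Data.Fin using (Fin; zero; suc; toℕ)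
open import Data.Product using (∃-syntax; Σ-syntax; _×_; _,_; proj₁; uncurry)
open import Function using (_∘_)
open import Data.Empty using (⊥; ⊥-elim)
open import Data.Sum using (_⊎_; inj₁; inj₂; [_,_])
open import Data.List using (List; []; _∷_; _++_)
open import Data.List.Relation.Unary.Any using (here; there)
open import Data.List.Membership.Propositional using (_∈_)
open import Data.List.Membership.Propositional.Properties using (∈-++⁺ˡ; ∈-++⁺ʳ)
open import Data.Unit using (⊤; tt)
open import Data.Maybe as Maybe using (Maybe; just; nothing; _>>=_)
open import Data.Maybe.Properties using (just-injective)
open import Relation.Binary.PropositionalEquality
  using (_≡_; _≢_; refl; sym; trans; cong; cong₂; subst; _≗_; module ≡-Reasoning)
open import Relation.Binary.Construct.Closure.ReflexiveTransitive using (Star; ε; _◅_; _◅◅_; gmap)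
open import Relation.Nullary using (¬_; yes; no)

variable
  m n k : ℕ

-- A binder remembers the name it carries in λα, so that terms
-- can be read back into λα.
data Λ (n : ℕ) : Set where
  gv : Var → Λ n
  bv : Fin n → Λ n
  ap : Λ n → Λ n → Λ n
  lm : Var → Λ (suc n) → Λ n

Ren : ℕ → ℕ → Set
Ren m n = Fin m → Fin n

Subst : ℕ → ℕ → Set
Subst m n = Fin m → Λ n

liftRen : Ren m n → Ren (suc m) (suc n)
liftRen ρ zero    = zero
liftRen ρ (suc i) = suc (ρ i)

rename : Ren m n → Λ m → Λ n
rename ρ (gv x)   = gv x
rename ρ (bv i)   = bv (ρ i)
rename ρ (ap a b) = ap (rename ρ a) (rename ρ b)
rename ρ (lm x a) = lm x (rename (liftRen ρ) a)

weaken : Λ n → Λ (suc n)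
weaken = rename suc

liftSubst : Subst m n → Subst (suc m) (suc n)
liftSubst σ zero    = bv zero
liftSubst σ (suc i) = weaken (σ i)

substitute : Subst m n → Λ m → Λ n
substitute σ (gv x)   = gv x
substitute σ (bv i)   = σ i
substitute σ (ap a b) = ap (substitute σ a) (substitute σ b)
substitute σ (lm x a) = lm x (substitute (liftSubst σ) a)

single : Λ n → Subst (suc n) n
single b zero    = b
single b (suc i) = bv i

shiftS : Subst n (suc n)
shiftS i = bv (suc i)

liftRen-cong : {ρ ρ' : Ren m n} → ρ ≗ ρ' → liftRen ρ ≗ liftRen ρ'
liftRen-cong e zero    = refl
liftRen-cong e (suc i) = cong suc (e i)

rename-cong : {ρ ρ' : Ren m n} → ρ ≗ ρ' → rename ρ ≗ rename ρ'
rename-cong e (gv x)   = refl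
rename-cong e (bv i)   = cong bv (e i)
rename-cong e (ap a b) = cong₂ ap (rename-cong e a) (rename-cong e b)
rename-cong e (lm x a) = cong (lm x) (rename-cong (liftRen-cong e) a)

liftSubst-cong : {σ σ' : Subst m n} → σ ≗ σ' → liftSubst σ ≗ liftSubst σ'
liftSubst-cong e zero    = refl
liftSubst-cong e (suc i) = cong weaken (e i)

substitute-cong : {σ σ' : Subst m n} → σ ≗ σ' → substitute σ ≗ substitute σ'
substitute-cong e (gv x)   = refl
substitute-cong e (bv i)   = e i
substitute-cong e (ap a b) = cong₂ ap (substitute-cong e a) (substitute-cong e b)
substitute-cong e (lm x a) = cong (lm x) (substitute-cong (liftSubst-cong e) a)

rename-rename : (ρ : Ren n k) (ρ' : Ren m n) (a : Λ m) →
                rename ρ (rename ρ' a) ≡ rename (ρ ∘ ρ') a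
rename-rename ρ ρ' (gv x)   = refl
rename-rename ρ ρ' (bv i)   = refl
rename-rename ρ ρ' (ap a b) = cong₂ ap (rename-rename ρ ρ' a) (rename-rename ρ ρ' b)
rename-rename ρ ρ' (lm x a) =
  cong (lm x) (trans (rename-rename (liftRen ρ) (liftRen ρ') a) (rename-cong lifts a))
  where
  lifts : liftRen ρ ∘ liftRen ρ' ≗ liftRen (ρ ∘ ρ')
  lifts zero    = refl
  lifts (suc i) = refl

substitute-rename : (σ : Subst n k) (ρ : Ren m n) (a : Λ m) →
                    substitute σ (rename ρ a) ≡ substitute (σ ∘ ρ) a
substitute-rename σ ρ (gv x)   = refl
substitute-rename σ ρ (bv i)   = refl
substitute-rename σ ρ (ap a b) = cong₂ ap (substitute-rename σ ρ a) (substitute-rename σ ρ b)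
substitute-rename σ ρ (lm x a) =
  cong (lm x) (trans (substitute-rename (liftSubst σ) (liftRen ρ) a) (substitute-cong lifts a))
  where
  lifts : liftSubst σ ∘ liftRen ρ ≗ liftSubst (σ ∘ ρ)
  lifts zero    = refl
  lifts (suc i) = refl

rename-substitute : (ρ : Ren n k) (σ : Subst m n) (a : Λ m) →
                    rename ρ (substitute σ a) ≡ substitute (rename ρ ∘ σ) a
rename-substitute ρ σ (gv x)   = refl
rename-substitute ρ σ (bv i)   = refl
rename-substitute ρ σ (ap a b) = cong₂ ap (rename-substitute ρ σ a) (rename-substitute ρ σ b)
rename-substitute ρ σ (lm x a) =
  cong (lm x) (trans (rename-substitute (liftRen ρ) (liftSubst σ) a) (substitute-cong lifts a))
  where
  lifts : rename (liftRen ρ) ∘ liftSubst σ ≗ liftSubst (rename ρ ∘ σ)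
  lifts zero    = refl
  lifts (suc i) = trans (rename-rename (liftRen ρ) suc (σ i)) (sym (rename-rename suc ρ (σ i)))

substitute-substitute : (σ : Subst n k) (τ : Subst m n) (a : Λ m) →
                        substitute σ (substitute τ a) ≡ substitute (substitute σ ∘ τ) a
substitute-substitute σ τ (gv x)   = refl
substitute-substitute σ τ (bv i)   = refl
substitute-substitute σ τ (ap a b) = cong₂ ap (substitute-substitute σ τ a) (substitute-substitute σ τ b)
substitute-substitute σ τ (lm x a) =
  cong (lm x) (trans (substitute-substitute (liftSubst σ) (liftSubst τ) a) (substitute-cong lifts a))
  where
  lifts : substitute (liftSubst σ) ∘ liftSubst τ ≗ liftSubst (substitute σ ∘ τ)
  lifts zero    = refl
  lifts (suc i) = trans (substitute-rename (liftSubst σ) suc (τ i)) (sym (rename-substitute suc σ (τ i)))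

substitute-id : (a : Λ n) → substitute bv a ≡ a
substitute-id (gv x)   = refl
substitute-id (bv i)   = refl
substitute-id (ap a b) = cong₂ ap (substitute-id a) (substitute-id b)
substitute-id (lm x a) = cong (lm x) (trans (substitute-cong lift-id a) (substitute-id a))
  where
  lift-id : liftSubst bv ≗ bv
  lift-id zero    = refl
  lift-id (suc i) = refl

rename-as-substitute : (ρ : Ren m n) (a : Λ m) → rename ρ a ≡ substitute (bv ∘ ρ) a
rename-as-substitute ρ (gv x)   = refl
rename-as-substitute ρ (bv i)   = refl
rename-as-substitute ρ (ap a b) = cong₂ ap (rename-as-substitute ρ a) (rename-as-substitute ρ b)
rename-as-substitute ρ (lm x a) =
  cong (lm x) (trans (rename-as-substitute (liftRen ρ) a) (substitute-cong lifts a))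
  where
  lifts : bv ∘ liftRen ρ ≗ liftSubst (bv ∘ ρ)
  lifts zero    = refl
  lifts (suc i) = refl

-- Consequences of the σ-calculus laws, one for each λα rule that moves a
-- substitution past a weakening, and one for β.

weaken-as-shift : (a : Λ n) → weaken a ≡ substitute shiftS a
weaken-as-shift = rename-as-substitute suc

single-shift : (b : Λ n) (a : Λ n) → substitute (single b) (substitute shiftS a) ≡ a
single-shift b a = trans (substitute-substitute (single b) shiftS a) (substitute-id a)

single-weaken : (b : Λ n) (a : Λ n) → substitute (single b) (weaken a) ≡ a
single-weaken b a = trans (substitute-rename (single b) suc a) (substitute-id a)

liftSubst-shift : (σ : Subst m n) (a : Λ m) →
                  substitute (liftSubst σ) (substitute shiftS a) ≡ substitute shiftS (substitute σ a)
liftSubst-shift σ a =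
  trans (substitute-substitute (liftSubst σ) shiftS a)
        (trans (substitute-cong (weaken-as-shift ∘ σ) a) (sym (substitute-substitute shiftS σ a)))

liftSubst-weaken : (σ : Subst m n) (a : Λ m) →
                   substitute (liftSubst σ) (weaken a) ≡ substitute shiftS (substitute σ a)
liftSubst-weaken σ a =
  trans (substitute-rename (liftSubst σ) suc a)
        (trans (substitute-cong (weaken-as-shift ∘ σ) a) (sym (substitute-substitute shiftS σ a)))

substitute-single : (σ : Subst m n) (a : Λ (suc m)) (b : Λ m) →
                    substitute (single (substitute σ b)) (substitute (liftSubst σ) a)
                    ≡ substitute σ (substitute (single b) a)
substitute-single σ a b =
  trans (substitute-substitute (single (substitute σ b)) (liftSubst σ) a)
        (trans (substitute-cong pointwise a) (sym (substitute-substitute σ (single b) a)))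
  where
  pointwise : substitute (single (substitute σ b)) ∘ liftSubst σ ≗ substitute σ ∘ single b
  pointwise zero    = refl
  pointwise (suc i) = single-weaken _ (σ i)

rename-single : (ρ : Ren m n) (b : Λ m) (a : Λ (suc m)) →
                rename ρ (substitute (single b) a) ≡ substitute (single (rename ρ b)) (rename (liftRen ρ) a)
rename-single ρ b a =
  trans (rename-substitute ρ (single b) a)
        (trans (substitute-cong pointwise a) (sym (substitute-rename (single (rename ρ b)) (liftRen ρ) a)))
  where
  pointwise : rename ρ ∘ single b ≗ single (rename ρ b) ∘ liftRen ρ
  pointwise zero    = refl
  pointwise (suc i) = refl

infix 4 _~_ _⇒_ _⇒*_
data _~_ {n} : Λ n → Λ n → Set where
  ~gv : ∀ {x} → gv x ~ gv x
  ~bv : ∀ {i} → bv i ~ bv i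
  ~ap : ∀ {a a' b b'} → a ~ a' → b ~ b' → ap a b ~ ap a' b'
  ~lm : ∀ {x y a a'} → a ~ a' → lm x a ~ lm y a'

~refl : (a : Λ n) → a ~ a
~refl (gv x)   = ~gv
~refl (bv i)   = ~bv
~refl (ap a b) = ~ap (~refl a) (~refl b)
~refl (lm x a) = ~lm (~refl a)

~sym : {a b : Λ n} → a ~ b → b ~ a
~sym ~gv       = ~gv
~sym ~bv       = ~bv
~sym (~ap p q) = ~ap (~sym p) (~sym q)
~sym (~lm p)   = ~lm (~sym p)

~trans : {a b c : Λ n} → a ~ b → b ~ c → a ~ c
~trans ~gv       ~gv       = ~gv
~trans ~bv       ~bv       = ~bv
~trans (~ap p q) (~ap r s) = ~ap (~trans p r) (~trans q s)
~trans (~lm p)   (~lm q)   = ~lm (~trans p q)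

rename-~ : (ρ : Ren m n) {a b : Λ m} → a ~ b → rename ρ a ~ rename ρ b
rename-~ ρ ~gv       = ~gv
rename-~ ρ ~bv       = ~bv
rename-~ ρ (~ap p q) = ~ap (rename-~ ρ p) (rename-~ ρ q)
rename-~ ρ (~lm p)   = ~lm (rename-~ (liftRen ρ) p)

liftSubst-~ : {σ σ' : Subst m n} → (∀ i → σ i ~ σ' i) → ∀ i → liftSubst σ i ~ liftSubst σ' i
liftSubst-~ e zero    = ~bv
liftSubst-~ e (suc i) = rename-~ suc (e i)

single-~ : {b b' : Λ n} → b ~ b' → ∀ i → single b i ~ single b' i
single-~ p zero    = p
single-~ p (suc i) = ~bv

substitute-~ : {σ σ' : Subst m n} → (∀ i → σ i ~ σ' i) →
               {a b : Λ m} → a ~ b → substitute σ a ~ substitute σ' b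
substitute-~ e ~gv          = ~gv
substitute-~ e (~bv {i = i}) = e i
substitute-~ e (~ap p q)    = ~ap (substitute-~ e p) (substitute-~ e q)
substitute-~ e (~lm p)      = ~lm (substitute-~ (liftSubst-~ e) p)

-- Parallel β-reduction on Λ.  Binder names may change along the way,
-- which is how the α-rule of λα is accounted for.
data _⇒_ {n} : Λ n → Λ n → Set where
  ⇒gv : ∀ {x} → gv x ⇒ gv x
  ⇒bv : ∀ {i} → bv i ⇒ bv i
  ⇒ap : ∀ {a a' b b'} → a ⇒ a' → b ⇒ b' → ap a b ⇒ ap a' b'
  ⇒lm : ∀ {x y a a'} → a ⇒ a' → lm x a ⇒ lm y a'
  ⇒β  : ∀ {x a a' b b'} → a ⇒ a' → b ⇒ b' → ap (lm x a) b ⇒ substitute (single b') a'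

_⇒*_ : Λ n → Λ n → Set
_⇒*_ = Star _⇒_

~→⇒ : {a b : Λ n} → a ~ b → a ⇒ b
~→⇒ ~gv       = ⇒gv
~→⇒ ~bv       = ⇒bv
~→⇒ (~ap p q) = ⇒ap (~→⇒ p) (~→⇒ q)
~→⇒ (~lm p)   = ⇒lm (~→⇒ p)

⇒refl : (a : Λ n) → a ⇒ a
⇒refl a = ~→⇒ (~refl a)

≡→⇒ : {a b : Λ n} → a ≡ b → a ⇒ b
≡→⇒ {a = a} refl = ⇒refl a

~-⇒ : {a b c : Λ n} → a ~ b → b ⇒ c → a ⇒ c
~-⇒ ~gv            ⇒gv       = ⇒gv
~-⇒ ~bv            ⇒bv       = ⇒bv
~-⇒ (~ap p q)      (⇒ap r s) = ⇒ap (~-⇒ p r) (~-⇒ q s)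
~-⇒ (~ap (~lm p) q) (⇒β r s) = ⇒β (~-⇒ p r) (~-⇒ q s)
~-⇒ (~lm p)        (⇒lm r)   = ⇒lm (~-⇒ p r)

rename-⇒ : (ρ : Ren m n) {a b : Λ m} → a ⇒ b → rename ρ a ⇒ rename ρ b
rename-⇒ ρ ⇒gv       = ⇒gv
rename-⇒ ρ ⇒bv       = ⇒bv
rename-⇒ ρ (⇒ap p q) = ⇒ap (rename-⇒ ρ p) (rename-⇒ ρ q)
rename-⇒ ρ (⇒lm p)   = ⇒lm (rename-⇒ (liftRen ρ) p)
rename-⇒ ρ (⇒β {a' = a'} {b' = b'} p q) =
  subst (_ ⇒_) (sym (rename-single ρ b' a')) (⇒β (rename-⇒ (liftRen ρ) p) (rename-⇒ ρ q))

liftSubst-⇒ : {σ σ' : Subst m n} → (∀ i → σ i ⇒ σ' i) → ∀ i → liftSubst σ i ⇒ liftSubst σ' i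
liftSubst-⇒ e zero    = ⇒bv
liftSubst-⇒ e (suc i) = rename-⇒ suc (e i)

single-⇒ : {b b' : Λ n} → b ⇒ b' → ∀ i → single b i ⇒ single b' i
single-⇒ p zero    = p
single-⇒ p (suc i) = ⇒bv

substitute-⇒ : {σ σ' : Subst m n} → (∀ i → σ i ⇒ σ' i) →
               {a b : Λ m} → a ⇒ b → substitute σ a ⇒ substitute σ' b
substitute-⇒ e ⇒gv          = ⇒gv
substitute-⇒ e (⇒bv {i = i}) = e i
substitute-⇒ e (⇒ap p q)    = ⇒ap (substitute-⇒ e p) (substitute-⇒ e q)
substitute-⇒ e (⇒lm p)      = ⇒lm (substitute-⇒ (liftSubst-⇒ e) p)
substitute-⇒ {σ' = σ'} e (⇒β {a' = a'} {b' = b'} p q) =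
  subst (_ ⇒_) (substitute-single σ' a' b') (⇒β (substitute-⇒ (liftSubst-⇒ e) p) (substitute-⇒ e q))

-- Takahashi's complete development: contract every redex of a at once.
develop : Λ n → Λ n
develop (gv x)          = gv x
develop (bv i)          = bv i
develop (ap (lm x a) b) = substitute (single (develop b)) (develop a)
develop (ap a b)        = ap (develop a) (develop b)
develop (lm x a)        = lm x (develop a)

triangle : {a b : Λ n} → a ⇒ b → b ⇒ develop a
triangle ⇒gv                          = ⇒gv
triangle ⇒bv                          = ⇒bv
triangle (⇒ap {a = lm x a} (⇒lm p) q) = ⇒β (triangle p) (triangle q)
triangle (⇒ap {a = gv x} p q)         = ⇒ap (triangle p) (triangle q)
triangle (⇒ap {a = bv i} p q)         = ⇒ap (triangle p) (triangle q)
triangle (⇒ap {a = ap a c} p q)       = ⇒ap (triangle p) (triangle q)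
triangle (⇒lm p)                      = ⇒lm (triangle p)
triangle (⇒β p q)                     = substitute-⇒ (single-⇒ (triangle q)) (triangle p)

strip : {a b c : Λ n} → a ⇒ b → a ⇒* c → ∃[ d ] (b ⇒* d × c ⇒ d)
strip {b = b} p ε        = b , ε , p
strip p (q ◅ qs) with strip (triangle q) qs
... | d , r , s = d , triangle p ◅ r , s

confluence : {a b c : Λ n} → a ⇒* b → a ⇒* c → ∃[ d ] (b ⇒* d × c ⇒* d)
confluence {c = c} ε qs = c , qs , ε
confluence (p ◅ ps) qs with strip p qs
... | d₁ , r , s with confluence ps r
... | d , t , u = d , t , s ◅ u

-- The local part of a context, as a snoc list of names; len (loc Γ) is the
-- number of de Bruijn indices with which terms in context Γ are interpreted.
infixl 5 _▸_
data Loc : Set where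
  ∙   : Loc
  _▸_ : Loc → Var → Loc

len : Loc → ℕ
len ∙       = zero
len (L ▸ x) = suc (len L)

loc : Ctx → Loc
loc (glob G) = ∙
loc (Γ ,, x) = loc Γ ▸ x

mutual
  interp : ∀ {Γ A} → Γ ⊢ A → Λ (len (loc Γ))
  interp (tGlob {x = x} _) = gv x
  interp tHere             = bv zero
  interp (tThere _ d)      = weaken (interp d)
  interp (tApp d e)        = ap (interp d) (interp e)
  interp (tLam {x = x} d)  = lm x (interp d)
  interp (tSub s d)        = substitute (interpSub s) (interp d)

  interpSub : ∀ {Γ S Δ} → Γ ⊢ S ▷ Δ → Subst (len (loc Δ)) (len (loc Γ))
  interpSub (tExt d)  = single (interp d)
  interpSub tW        = shiftS
  interpSub tRen      = bv
  interpSub (tLift s) = liftSubst (interpSub s)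

-- Every substitution rule is an equation of the
-- σ-calculus; β is a parallel β-step; α only changes a binder name.
mutual
  step-sim : ∀ {Γ A B} (d : Γ ⊢ A) → A ⟶ B → ∃[ d' ] (interp d ⇒ interp {Γ} {B} d')
  step-sim (tApp (tLam da) db) beta = tSub (tExt db) da , ⇒β (⇒refl _) (⇒refl _)
  step-sim (tSub s (tApp da db)) sApp = tApp (tSub s da) (tSub s db) , ⇒refl _
  step-sim (tSub s (tLam da)) sLam = tLam (tSub (tLift s) da) , ⇒refl _
  step-sim (tSub (tExt db) tHere) extVar = db , ⇒refl _
  step-sim (tSub (tExt db) (tThere x≢x _)) extVar = ⊥-elim (x≢x refl)
  step-sim (tSub (tExt db) (tSub tW da)) extW = da , ≡→⇒ (single-shift (interp db) (interp da))
  step-sim (tSub (tExt db) tHere) (extOther x≢x) = ⊥-elim (x≢x refl)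
  step-sim (tSub (tExt db) (tThere _ d)) (extOther _) = d , ≡→⇒ (single-weaken (interp db) (interp d))
  step-sim (tSub tRen tHere) renVar = tHere , ⇒bv
  step-sim (tSub tRen (tThere x≢x _)) renVar = ⊥-elim (x≢x refl)
  step-sim (tSub tRen (tSub tW da)) renW = tSub tW da , ≡→⇒ (substitute-id _)
  step-sim (tSub tRen tHere) (renOther x≢x) = ⊥-elim (x≢x refl)
  step-sim (tSub tRen (tThere _ d)) (renOther _) =
    tSub tW d , ≡→⇒ (trans (substitute-id _) (weaken-as-shift (interp d)))
  step-sim (tSub (tLift s) tHere) liftVar = tHere , ⇒bv
  step-sim (tSub (tLift s) (tThere x≢x _)) liftVar = ⊥-elim (x≢x refl)
  step-sim (tSub (tLift s) (tSub tW da)) liftW =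
    tSub tW (tSub s da) , ≡→⇒ (liftSubst-shift (interpSub s) (interp da))
  step-sim (tSub (tLift s) tHere) (liftOther x≢x) = ⊥-elim (x≢x refl)
  step-sim (tSub (tLift s) (tThere _ d)) (liftOther _) =
    tSub tW (tSub s d) , ≡→⇒ (liftSubst-weaken (interpSub s) (interp d))
  step-sim (tSub tW d) (wOther y≢x) = tThere (y≢x ∘ sym) d , ≡→⇒ (sym (weaken-as-shift (interp d)))
  step-sim (tLam da) (alpha _ _ _) = tLam (tSub tRen da) , ⇒lm (≡→⇒ (sym (substitute-id (interp da))))
  step-sim (tApp da db) (appL p) with step-sim da p
  ... | da' , q = tApp da' db , ⇒ap q (⇒refl _)
  step-sim (tApp da db) (appR p) with step-sim db p
  ... | db' , q = tApp da db' , ⇒ap (⇒refl _) q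
  step-sim (tLam da) (lamC p) with step-sim da p
  ... | da' , q = tLam da' , ⇒lm q
  step-sim (tSub s da) (subS p) with stepSub-sim s p
  ... | s' , e = tSub s' da , substitute-⇒ e (⇒refl (interp da))
  step-sim (tSub s da) (subT p) with step-sim da p
  ... | da' , q = tSub s da' , substitute-⇒ (⇒refl ∘ interpSub s) q

  stepSub-sim : ∀ {Γ S S' Δ} (s : Γ ⊢ S ▷ Δ) → S ⟶ˢ S' →
                ∃[ s' ] (∀ i → interpSub s i ⇒ interpSub {Γ} {S'} {Δ} s' i)
  stepSub-sim (tExt db) (extC p) with step-sim db p
  ... | db' , q = tExt db' , single-⇒ q
  stepSub-sim (tLift s) (liftC p) with stepSub-sim s p
  ... | s' , e = tLift s' , liftSubst-⇒ e

steps-sim : ∀ {Γ A B} (d : Γ ⊢ A) → A ↠ B → ∃[ d' ] (interp d ⇒* interp {Γ} {B} d')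
steps-sim d ε = d , ε
steps-sim d (p ◅ ps) with step-sim d p
... | d₁ , q with steps-sim d₁ ps
... | d' , qs = d' , q ◅ qs

_↠ˢ_ : Sub → Sub → Set
_↠ˢ_ = Star _⟶ˢ_

app-↠ : ∀ {A A' B B'} → A ↠ A' → B ↠ B' → app A B ↠ app A' B'
app-↠ {B = B} r s = gmap (λ t → app t B) appL r ◅◅ gmap (app _) appR s

lam-↠ : ∀ {x A A'} → A ↠ A' → lam x A ↠ lam x A'
lam-↠ {x} = gmap (lam x) lamC

subT-↠ : ∀ {S A A'} → A ↠ A' → sub S A ↠ sub S A'
subT-↠ {S} = gmap (sub S) subT

-- weakenBy y t is W y ∘ t, with the contraction W y ∘ z → z (z ≠ y) already
-- performed; it is how weakening appears in read-back terms.
weakenBy : Var → Tm → Tm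
weakenBy y (var z) with y ≟ z
... | yes _ = sub (W y) (var z)
... | no  _ = var z
weakenBy y t = sub (W y) t

readGlobal : Loc → Var → Tm
readGlobal ∙       x = var x
readGlobal (L ▸ y) x = weakenBy y (readGlobal L x)

readBound : (L : Loc) → Fin (len L) → Tm
readBound (L ▸ y) zero    = var y
readBound (L ▸ y) (suc i) = weakenBy y (readBound L i)

readback : (L : Loc) → Λ (len L) → Tm
readback L (gv x)   = readGlobal L x
readback L (bv i)   = readBound L i
readback L (ap a b) = app (readback L a) (readback L b)
readback L (lm x a) = lam x (readback (L ▸ x) a)

W-weakenBy : ∀ y t → sub (W y) t ↠ weakenBy y t
W-weakenBy y (var z) with y ≟ z
... | yes _   = ε
... | no y≢z  = wOther y≢z ◅ ε
W-weakenBy y (app a b) = ε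
W-weakenBy y (lam x a) = ε
W-weakenBy y (sub s a) = ε

ext-weakenBy : ∀ B x t → sub (ext B x) (weakenBy x t) ↠ t
ext-weakenBy B x (var z) with x ≟ z
... | yes refl = extW ◅ ε
... | no x≢z   = extOther x≢z ◅ ε
ext-weakenBy B x (app a b) = extW ◅ ε
ext-weakenBy B x (lam y a) = extW ◅ ε
ext-weakenBy B x (sub s a) = extW ◅ ε

ren-weakenBy : ∀ y x t → sub (ren y x) (weakenBy x t) ↠ weakenBy y t
ren-weakenBy y x (var z) with x ≟ z
... | yes refl = renW ◅ W-weakenBy y (var x)
... | no x≢z   = renOther x≢z ◅ W-weakenBy y (var z)
ren-weakenBy y x (app a b) = renW ◅ ε
ren-weakenBy y x (lam z a) = renW ◅ ε
ren-weakenBy y x (sub s a) = renW ◅ ε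

lift-weakenBy : ∀ S x t → sub (lift S x) (weakenBy x t) ↠ sub (W x) (sub S t)
lift-weakenBy S x (var z) with x ≟ z
... | yes refl = liftW ◅ ε
... | no x≢z   = liftOther x≢z ◅ ε
lift-weakenBy S x (app a b) = liftW ◅ ε
lift-weakenBy S x (lam z a) = liftW ◅ ε
lift-weakenBy S x (sub s a) = liftW ◅ ε

-- Implements Γ S Δ σ: the λα substitution S, from read-back context Δ to
-- read-back context Γ, is a syntactic rendering of the Λ-substitution σ.
data Implements : (Γ : Loc) → Sub → (Δ : Loc) → Subst (len Δ) (len Γ) → Set where
  iExt  : ∀ {Γ x b} → Implements Γ (ext (readback Γ b) x) (Γ ▸ x) (single b)
  iW    : ∀ {Γ x} → Implements (Γ ▸ x) (W x) Γ shiftS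
  iRen  : ∀ {Θ x y} → Implements (Θ ▸ y) (ren y x) (Θ ▸ x) bv
  iLift : ∀ {Γ Δ S σ x} → Implements Γ S Δ σ → Implements (Γ ▸ x) (lift S x) (Δ ▸ x) (liftSubst σ)

global-sim : ∀ {Γ S Δ σ} → Implements Γ S Δ σ → ∀ g → sub S (readGlobal Δ g) ↠ readGlobal Γ g
global-sim iExt g = ext-weakenBy _ _ _
global-sim iW g = W-weakenBy _ _
global-sim {Θ ▸ y} {Δ = Θ ▸ x} iRen g = ren-weakenBy y x (readGlobal Θ g)
global-sim {Γ ▸ x} (iLift s) g = lift-weakenBy _ _ _ ◅◅ subT-↠ (global-sim s g) ◅◅ W-weakenBy x _

-- Under a binder the
-- lifted substitution needs W x ∘ readback Γ t ↠ readback (Γ ▸ x) (weaken t)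
-- for the images t of σ; this is first established for substitutions whose
-- images are variables (where it is immediate), which gives it for all t,
-- and then for arbitrary substitutions.  The module abstracts over the
-- class of admissible images.
module SubstitutionSim
  (Admissible : ∀ {n} → Λ n → Set)
  (bv-admissible : ∀ {n} {i : Fin n} → Admissible (bv i))
  (weaken-admissible : ∀ {n} {t : Λ n} → Admissible t → Admissible (weaken t))
  (W-sim : ∀ L x (t : Λ (len L)) → Admissible t →
           sub (W x) (readback L t) ↠ readback (L ▸ x) (weaken t))
  where

  -- the only terms an implemented substitution inserts are the ones of [b/x]
  AdmissibleImages : ∀ {Γ S Δ σ} → Implements Γ S Δ σ → Set
  AdmissibleImages (iExt {b = b}) = Admissible b
  AdmissibleImages iW             = ⊤
  AdmissibleImages iRen           = ⊤
  AdmissibleImages (iLift s)      = AdmissibleImages s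

  -- hence every image of σ is admissible (lifting only adds bv and weakenings)
  images-admissible : ∀ {Γ S Δ σ} (s : Implements Γ S Δ σ) → AdmissibleImages s →
                      ∀ i → Admissible (σ i)
  images-admissible iExt adm zero        = adm
  images-admissible iExt adm (suc i)     = bv-admissible
  images-admissible iW adm i             = bv-admissible
  images-admissible iRen adm i           = bv-admissible
  images-admissible (iLift s) adm zero    = bv-admissible
  images-admissible (iLift s) adm (suc i) = weaken-admissible (images-admissible s adm i)

  bound-sim : ∀ {Γ S Δ σ} (s : Implements Γ S Δ σ) → AdmissibleImages s →
              ∀ i → sub S (readBound Δ i) ↠ readback Γ (σ i)
  bound-sim iExt adm zero = extVar ◅ ε
  bound-sim iExt adm (suc i) = ext-weakenBy _ _ _
  bound-sim iW adm i = W-weakenBy _ _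
  bound-sim iRen adm zero = renVar ◅ ε
  bound-sim {Θ ▸ y} {Δ = Θ ▸ x} iRen adm (suc i) = ren-weakenBy y x (readBound Θ i)
  bound-sim (iLift s) adm zero = liftVar ◅ ε
  bound-sim {Γ ▸ x} (iLift {σ = σ} s) adm (suc i) =
    lift-weakenBy _ _ _ ◅◅ subT-↠ (bound-sim s adm i) ◅◅ W-sim Γ x (σ i) (images-admissible s adm i)

  substitute-sim : ∀ {Γ S Δ σ} (s : Implements Γ S Δ σ) → AdmissibleImages s →
                   ∀ a → sub S (readback Δ a) ↠ readback Γ (substitute σ a)
  substitute-sim s adm (gv x)   = global-sim s x
  substitute-sim s adm (bv i)   = bound-sim s adm i
  substitute-sim s adm (ap a b) = sApp ◅ app-↠ (substitute-sim s adm a) (substitute-sim s adm b)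
  substitute-sim s adm (lm x a) = sLam ◅ lam-↠ (substitute-sim (iLift s) adm a)

data IsVar {n} : Λ n → Set where
  isBound  : ∀ {i} → IsVar (bv i)
  isGlobal : ∀ {x} → IsVar (gv x)

weaken-IsVar : {t : Λ n} → IsVar t → IsVar (weaken t)
weaken-IsVar isBound  = isBound
weaken-IsVar isGlobal = isGlobal

readback-weaken-var : ∀ L y {t : Λ (len L)} → IsVar t → readback (L ▸ y) (weaken t) ≡ weakenBy y (readback L t)
readback-weaken-var L y isBound  = refl
readback-weaken-var L y isGlobal = refl

module VariableSim = SubstitutionSim IsVar isBound weaken-IsVar
  (λ L x t isVar → subst (sub (W x) (readback L t) ↠_) (sym (readback-weaken-var L x isVar)) (W-weakenBy x _))

W-readback : ∀ L x (t : Λ (len L)) → sub (W x) (readback L t) ↠ readback (L ▸ x) (weaken t)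
W-readback L x t =
  subst (λ u → sub (W x) (readback L t) ↠ readback (L ▸ x) u) (sym (weaken-as-shift t))
        (VariableSim.substitute-sim iW tt t)

module TermSim = SubstitutionSim (λ _ → ⊤) tt (λ _ → tt) (λ L x t _ → W-readback L x t)

substitute-readback : ∀ {Γ S Δ σ} → Implements Γ S Δ σ →
                      ∀ a → sub S (readback Δ a) ↠ readback Γ (substitute σ a)
substitute-readback s = TermSim.substitute-sim s (all-admissible s)
  where
  all-admissible : ∀ {Γ S Δ σ} (s : Implements Γ S Δ σ) → TermSim.AdmissibleImages s
  all-admissible iExt      = tt
  all-admissible iW        = tt
  all-admissible iRen      = tt
  all-admissible (iLift s) = all-admissible s

interp-IsVar : ∀ {Γ x} (d : Γ ⊢ var x) → IsVar (interp d)
interp-IsVar (tGlob _)    = isGlobal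
interp-IsVar tHere        = isBound
interp-IsVar (tThere _ d) = weaken-IsVar (interp-IsVar d)

weakenBy-other : ∀ {x y} → x ≢ y → weakenBy y (var x) ≡ var x
weakenBy-other {x} {y} x≢y with y ≟ x
... | yes y≡x = ⊥-elim (x≢y (sym y≡x))
... | no _    = refl

readback-interp-var : ∀ {Γ x} (d : Γ ⊢ var x) → readback (loc Γ) (interp d) ≡ var x
readback-interp-var (tGlob _) = refl
readback-interp-var tHere     = refl
readback-interp-var {Γ ,, y} {x} (tThere x≢y d) = begin
  readback (loc Γ ▸ y) (weaken (interp d))   ≡⟨ readback-weaken-var (loc Γ) y (interp-IsVar d) ⟩
  weakenBy y (readback (loc Γ) (interp d))   ≡⟨ cong (weakenBy y) (readback-interp-var d) ⟩
  weakenBy y (var x)                         ≡⟨ weakenBy-other x≢y ⟩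
  var x                                      ∎
  where open ≡-Reasoning

mutual
  reduces-to-readback : ∀ {Γ A} (d : Γ ⊢ A) → A ↠ readback (loc Γ) (interp d)
  reduces-to-readback (tGlob _) = ε
  reduces-to-readback tHere = ε
  reduces-to-readback {A = var x} d@(tThere _ _) = subst (var x ↠_) (sym (readback-interp-var d)) ε
  reduces-to-readback (tApp d e) = app-↠ (reduces-to-readback d) (reduces-to-readback e)
  reduces-to-readback (tLam d) = lam-↠ (reduces-to-readback d)
  reduces-to-readback (tSub {S = S} s d) with reduces-to-implementation s
  ... | S' , S↠S' , impl =
    subT-↠ (reduces-to-readback d) ◅◅ gmap (λ T → sub T _) subS S↠S' ◅◅ substitute-readback impl (interp d)

  reduces-to-implementation : ∀ {Γ S Δ} (s : Γ ⊢ S ▷ Δ) →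
                              ∃[ S' ] (S ↠ˢ S' × Implements (loc Γ) S' (loc Δ) (interpSub s))
  reduces-to-implementation (tExt {x = x} d) = _ , gmap (λ B → ext B x) extC (reduces-to-readback d) , iExt
  reduces-to-implementation tW = _ , ε , iW
  reduces-to-implementation tRen = _ , ε , iRen
  reduces-to-implementation (tLift {x = x} s) with reduces-to-implementation s
  ... | S' , S↠S' , impl = lift S' x , gmap (λ T → lift T x) liftC S↠S' , iLift impl

-- Backward simulation: a parallel step on Λ is realised by λα reduction on
-- read-backs, up to binder names (the names of the reduct are those of the
-- source, not the ones chosen by ⇒lm).
parallel-step-sim : ∀ L {a b : Λ (len L)} → a ⇒ b → ∃[ b' ] (b' ~ b × readback L a ↠ readback L b')
parallel-step-sim L ⇒gv = _ , ~gv , ε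
parallel-step-sim L ⇒bv = _ , ~bv , ε
parallel-step-sim L (⇒ap p q) with parallel-step-sim L p | parallel-step-sim L q
... | a' , a'~ , r | b' , b'~ , s = ap a' b' , ~ap a'~ b'~ , app-↠ r s
parallel-step-sim L (⇒lm {x = x} p) with parallel-step-sim (L ▸ x) p
... | a' , a'~ , r = lm x a' , ~lm a'~ , lam-↠ r
parallel-step-sim L (⇒β {x = x} p q) with parallel-step-sim (L ▸ x) p | parallel-step-sim L q
... | a' , a'~ , r | b' , b'~ , s =
  substitute (single b') a' , substitute-~ (single-~ b'~) a'~ ,
  app-↠ (lam-↠ r) s ◅◅ beta ◅ substitute-readback iExt a'

parallel-steps-sim : ∀ L {a₀ a b : Λ (len L)} → a₀ ~ a → a ⇒* b →
                     ∃[ b' ] (b' ~ b × readback L a₀ ↠ readback L b')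
parallel-steps-sim L {a₀} a₀~a ε = a₀ , a₀~a , ε
parallel-steps-sim L a₀~a (p ◅ ps) with parallel-step-sim L (~-⇒ a₀~a p)
... | a₁ , a₁~ , r with parallel-steps-sim L a₁~ ps
... | b' , b'~ , s = b' , b'~ , r ◅◅ s

mutual
  translation-typing : ∀ {Γ A a} → Γ ⊩ A ⇝ a → Γ ⊢ A
  translation-typing (rGlob x∈G)  = tGlob x∈G
  translation-typing rHere        = tHere
  translation-typing (rThere T x≢y) = tThere x≢y (translation-typing T)
  translation-typing (rApp T U)   = tApp (translation-typing T) (translation-typing U)
  translation-typing (rLam T)     = tLam (translation-typing T)
  translation-typing (rSub Ts T)  = tSub (translationSub-typing Ts) (translation-typing T)

  translationSub-typing : ∀ {Γ S Δ s} → Γ ⊩ˢ S ▷ Δ ⇝ s → Γ ⊢ S ▷ Δ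
  translationSub-typing (rExt T)   = tExt (translation-typing T)
  translationSub-typing rW         = tW
  translationSub-typing rRen       = tRen
  translationSub-typing (rLift Ts) = tLift (translationSub-typing Ts)

-- Evaluation of λυ'-terms into Λ at a given depth (partial: ill-scoped
-- indices have no value).  Binders get an arbitrary name.
mutual
  evalU : (n : ℕ) → UTm → Maybe (Λ n)
  evalU n       (uvar x)   = just (gv x)
  evalU zero    one        = nothing
  evalU (suc n) one        = just (bv zero)
  evalU n       (uapp a b) = evalU n a >>= λ u → evalU n b >>= λ v → just (ap u v)
  evalU n       (ulam a)   = evalU (suc n) a >>= λ u → just (lm 0 u)
  evalU n       (uclo a s) = evalUSub n s >>= λ (m , σ) → evalU m a >>= λ u → just (substitute σ u)

  evalUSub : (n : ℕ) → USub → Maybe (∃[ m ] Subst m n)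
  evalUSub n       (slash b) = evalU n b >>= λ v → just (suc n , single v)
  evalUSub zero    shift     = nothing
  evalUSub (suc n) shift     = just (n , shiftS)
  evalUSub n       uid       = just (n , bv)
  evalUSub zero    (⇑ s)     = nothing
  evalUSub (suc n) (⇑ s)     = Maybe.map (λ (m , σ) → suc m , liftSubst σ) (evalUSub n s)

-- The λυ'-translation of a term determines its interpretation up to
-- binder names: both agree with the evaluation of the translation.
mutual
  evalU-translation : ∀ {Γ A a} (T : Γ ⊩ A ⇝ a) →
                      ∃[ v ] (evalU (len (loc Γ)) a ≡ just v × interp (translation-typing T) ~ v)
  evalU-translation (rGlob _) = _ , refl , ~gv
  evalU-translation rHere = _ , refl , ~bv
  evalU-translation (rThere T _) with evalU-translation T
  ... | v , eval≡ , interp~v rewrite eval≡ =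
    substitute shiftS v , refl , subst (_~ substitute shiftS v) (sym (weaken-as-shift _))
                                       (substitute-~ (λ _ → ~bv) interp~v)
  evalU-translation (rApp T U) with evalU-translation T | evalU-translation U
  ... | v , eval≡ , interp~v | w , eval≡' , interp~w rewrite eval≡ | eval≡' =
    ap v w , refl , ~ap interp~v interp~w
  evalU-translation (rLam T) with evalU-translation T
  ... | v , eval≡ , interp~v rewrite eval≡ = lm 0 v , refl , ~lm interp~v
  evalU-translation (rSub Ts T) with evalUSub-translation Ts | evalU-translation T
  ... | σ , eval≡ , interp~σ | v , eval≡' , interp~v rewrite eval≡ | eval≡' =
    substitute σ v , refl , substitute-~ interp~σ interp~v

  evalUSub-translation : ∀ {Γ S Δ s} (T : Γ ⊩ˢ S ▷ Δ ⇝ s) →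
                         ∃[ σ ] (evalUSub (len (loc Γ)) s ≡ just (len (loc Δ) , σ) ×
                                 (∀ i → interpSub (translationSub-typing T) i ~ σ i))
  evalUSub-translation (rExt T) with evalU-translation T
  ... | v , eval≡ , interp~v rewrite eval≡ = single v , refl , single-~ interp~v
  evalUSub-translation rW = shiftS , refl , λ _ → ~bv
  evalUSub-translation rRen = bv , refl , λ _ → ~bv
  evalUSub-translation (rLift Ts) with evalUSub-translation Ts
  ... | σ , eval≡ , interp~σ rewrite eval≡ = liftSubst σ , refl , liftSubst-~ interp~σ

same-translation-~ : ∀ {Γ A₁ A₂ a} (T₁ : Γ ⊩ A₁ ⇝ a) (T₂ : Γ ⊩ A₂ ⇝ a) →
                     interp (translation-typing T₁) ~ interp (translation-typing T₂)
same-translation-~ T₁ T₂ with evalU-translation T₁ | evalU-translation T₂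
... | v₁ , eval≡₁ , interp~v₁ | v₂ , eval≡₂ , interp~v₂
  rewrite just-injective (trans (sym eval≡₁) eval≡₂) = ~trans interp~v₁ (~sym interp~v₂)

_∈ˡ_ : Var → Loc → Set
x ∈ˡ ∙       = ⊥
x ∈ˡ (L ▸ y) = x ≡ y ⊎ x ∈ˡ L

-- FVShape L Φ: the local part of Φ is a final segment of L; the earlier
-- names of L are no longer recorded in Φ.
data FVShape : Loc → Ctx → Set where
  globals : ∀ {L H} → FVShape L (glob H)
  local   : ∀ {L Φ y} → FVShape L Φ → FVShape (L ▸ y) (Φ ,, y)

-- Visible s x: x is in the global part of Φ and is not one of the names of
-- L that Φ has already discarded (so x is genuinely global, not shadowed).
Visible : ∀ {L Φ} → FVShape L Φ → Var → Set
Visible (globals {L} {H}) x = x ∈ H × ¬ x ∈ˡ L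
Visible (local s) x         = Visible s x

data _∈ᵍ_ (x : Var) {n} : Λ n → Set where
  here-gv : x ∈ᵍ gv x
  in-apˡ  : ∀ {a b} → x ∈ᵍ a → x ∈ᵍ ap a b
  in-apʳ  : ∀ {a b} → x ∈ᵍ b → x ∈ᵍ ap a b
  in-lm   : ∀ {y a} → x ∈ᵍ a → x ∈ᵍ lm y a

∈-remove : ∀ {x y} H → x ∈ H → x ≢ y → x ∈ remove y H
∈-remove {x} {y} (z ∷ H) (here refl) x≢y with y ≟ z
... | yes y≡x = ⊥-elim (x≢y (sym y≡x))
... | no _    = here refl
∈-remove {x} {y} (z ∷ H) (there x∈H) x≢y with y ≟ z
... | yes _ = ∈-remove H x∈H x≢y
... | no _  = there (∈-remove H x∈H x≢y)

visible-remove : ∀ {x y L} H → x ∈ H → ¬ x ∈ˡ (L ▸ y) → x ∈ remove y H × ¬ x ∈ˡ L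
visible-remove H x∈H x∉ = ∈-remove H x∈H (x∉ ∘ inj₁) , x∉ ∘ inj₂

FV-weakenBy : ∀ L y R Φ → FV R ≡ just Φ → (s : FVShape L Φ) →
              ∃[ Φ' ] (FV (weakenBy y R) ≡ just Φ' ×
                       Σ[ s' ∈ FVShape (L ▸ y) Φ' ] (∀ x → Visible s x → Visible s' x))
FV-weakenBy L y (var z) .(glob (z ∷ [])) refl globals with y ≟ z
... | yes _  = _ , refl , local globals , λ x vis → vis
... | no y≢z = _ , refl , globals , λ { x (here refl , z∉L) → here refl , [ y≢z ∘ sym , z∉L ] }
FV-weakenBy L y (app a b) Φ FV≡ s rewrite FV≡ = _ , refl , local s , λ x vis → vis
FV-weakenBy L y (lam z a) Φ FV≡ s rewrite FV≡ = _ , refl , local s , λ x vis → vis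
FV-weakenBy L y (sub S a) Φ FV≡ s rewrite FV≡ = _ , refl , local s , λ x vis → vis

FV-readGlobal : ∀ L g → ∃[ Φ ] (FV (readGlobal L g) ≡ just Φ × Σ[ s ∈ FVShape L Φ ] Visible s g)
FV-readGlobal ∙ g = _ , refl , globals , here refl , λ ()
FV-readGlobal (L ▸ y) g with FV-readGlobal L g
... | Φ , FV≡ , s , vis with FV-weakenBy L y (readGlobal L g) Φ FV≡ s
... | Φ' , FV≡' , s' , keep = Φ' , FV≡' , s' , keep g vis

FV-readBound : ∀ L i → ∃[ Φ ] (FV (readBound L i) ≡ just Φ × FVShape L Φ)
FV-readBound (L ▸ y) zero = _ , refl , globals
FV-readBound (L ▸ y) (suc i) with FV-readBound L i
... | Φ , FV≡ , s with FV-weakenBy L y (readBound L i) Φ FV≡ s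
... | Φ' , FV≡' , s' , _ = Φ' , FV≡' , s'

⊔G-shape : ∀ {L Φ₂} H (s₂ : FVShape L Φ₂) →
           ∃[ Φ ] (⊔G H Φ₂ ≡ just Φ × Σ[ s ∈ FVShape L Φ ]
                   ((∀ x → x ∈ H → ¬ x ∈ˡ L → Visible s x) × (∀ x → Visible s₂ x → Visible s x)))
⊔G-shape H (globals {H = H₂}) =
  _ , refl , globals , (λ x x∈H x∉L → ∈-++⁺ˡ x∈H , x∉L) , (λ { x (x∈H₂ , x∉L) → ∈-++⁺ʳ H x∈H₂ , x∉L })
⊔G-shape {L ▸ y} H (local s₂) with ⊔G-shape (remove y H) s₂
... | Φ , ⊔≡ , s , keep₁ , keep₂ rewrite ⊔≡ =
  _ , refl , local s , (λ x x∈H x∉ → uncurry (keep₁ x) (visible-remove H x∈H x∉)) , keep₂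

G⊔-shape : ∀ {L Φ₁} H (s₁ : FVShape L Φ₁) →
           ∃[ Φ ] (G⊔ Φ₁ H ≡ just Φ × Σ[ s ∈ FVShape L Φ ]
                   ((∀ x → x ∈ H → ¬ x ∈ˡ L → Visible s x) × (∀ x → Visible s₁ x → Visible s x)))
G⊔-shape H (globals {H = H₁}) =
  _ , refl , globals , (λ x x∈H x∉L → ∈-++⁺ʳ H₁ x∈H , x∉L) , (λ { x (x∈H₁ , x∉L) → ∈-++⁺ˡ x∈H₁ , x∉L })
G⊔-shape {L ▸ y} H (local s₁) with G⊔-shape (remove y H) s₁
... | Φ , ⊔≡ , s , keep₁ , keep₂ rewrite ⊔≡ =
  _ , refl , local s , (λ x x∈H x∉ → uncurry (keep₁ x) (visible-remove H x∈H x∉)) , keep₂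

⊔-shape : ∀ {L Φ₁ Φ₂} (s₁ : FVShape L Φ₁) (s₂ : FVShape L Φ₂) →
          ∃[ Φ ] (Φ₁ ⊔ Φ₂ ≡ just Φ × Σ[ s ∈ FVShape L Φ ]
                  ((∀ x → Visible s₁ x → Visible s x) × (∀ x → Visible s₂ x → Visible s x)))
⊔-shape (globals {H = H₁}) s₂ with ⊔G-shape H₁ s₂
... | Φ , ⊔≡ , s , keep₁ , keep₂ = Φ , ⊔≡ , s , (λ x → uncurry (keep₁ x)) , keep₂
⊔-shape (local s₁) (globals {H = H₂}) with G⊔-shape H₂ (local s₁)
... | Φ , ⊔≡ , s , keep₂ , keep₁ = Φ , ⊔≡ , s , keep₁ , (λ x → uncurry (keep₂ x))
⊔-shape {L ▸ y} (local s₁) (local s₂) with y ≟ y | ⊔-shape s₁ s₂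
... | no y≢y | _ = ⊥-elim (y≢y refl)
... | yes _  | Φ , ⊔≡ , s , keep₁ , keep₂ rewrite ⊔≡ = _ , refl , local s , keep₁ , keep₂

FV-readback : ∀ L (t : Λ (len L)) →
              ∃[ Φ ] (FV (readback L t) ≡ just Φ × Σ[ s ∈ FVShape L Φ ] (∀ x → x ∈ᵍ t → Visible s x))
FV-readback L (gv g) with FV-readGlobal L g
... | Φ , FV≡ , s , vis = Φ , FV≡ , s , λ { x here-gv → vis }
FV-readback L (bv i) with FV-readBound L i
... | Φ , FV≡ , s = Φ , FV≡ , s , λ x ()
FV-readback L (ap a b) with FV-readback L a | FV-readback L b
... | Φ₁ , FV≡₁ , s₁ , vis₁ | Φ₂ , FV≡₂ , s₂ , vis₂ with ⊔-shape s₁ s₂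
... | Φ , ⊔≡ , s , keep₁ , keep₂ rewrite FV≡₁ | FV≡₂ =
  Φ , ⊔≡ , s , λ { x (in-apˡ x∈) → keep₁ x (vis₁ x x∈) ; x (in-apʳ x∈) → keep₂ x (vis₂ x x∈) }
FV-readback L (lm y a) with FV-readback (L ▸ y) a
... | .(glob H) , FV≡ , globals {H = H} , vis rewrite FV≡ =
  _ , refl , globals , λ { x (in-lm x∈) → uncurry (visible-remove H) (vis x x∈) }
... | .(Φ ,, y) , FV≡ , local {Φ = Φ} s , vis rewrite FV≡ with y ≟ y
...   | no y≢y = ⊥-elim (y≢y refl)
...   | yes _  = Φ , refl , s , λ { x (in-lm x∈) → vis x x∈ }

shifted : ℕ → UTm → UTm
shifted zero    u = u
shifted (suc k) u = uclo (shifted k u) shift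

-- The λυ'-term that the read-back of t translates to.  It does not depend
-- on binder names, which is why ~-related Λ-terms have α-equivalent read-backs.
⌜_⌝ : Λ n → UTm
⌜_⌝ {n} (gv x) = shifted n (uvar x)
⌜ bv i ⌝       = shifted (toℕ i) one
⌜ ap a b ⌝     = uapp ⌜ a ⌝ ⌜ b ⌝
⌜ lm x a ⌝     = ulam ⌜ a ⌝

⌜⌝-~ : {a b : Λ n} → a ~ b → ⌜ a ⌝ ≡ ⌜ b ⌝
⌜⌝-~ ~gv       = refl
⌜⌝-~ ~bv       = refl
⌜⌝-~ (~ap p q) = cong₂ uapp (⌜⌝-~ p) (⌜⌝-~ q)
⌜⌝-~ (~lm p)   = cong ulam (⌜⌝-~ p)

globalsOf : Ctx → List Var
globalsOf (glob G) = G
globalsOf (Γ ,, x) = globalsOf Γ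

-- weakenBy y translates to a shift, whether or not the W y was contracted
translate-weakenBy : ∀ {Γ R u} y → Γ ⊩ R ⇝ u → (Γ ,, y) ⊩ weakenBy y R ⇝ uclo u shift
translate-weakenBy {R = var z} y T with y ≟ z
... | yes _  = rSub rW T
... | no y≢z = rThere T (y≢z ∘ sym)
translate-weakenBy {R = app a b} y T = rSub rW T
translate-weakenBy {R = lam x a} y T = rSub rW T
translate-weakenBy {R = sub S a} y T = rSub rW T

translate-readGlobal : ∀ Γ x → x ∈ globalsOf Γ → Γ ⊩ readGlobal (loc Γ) x ⇝ shifted (len (loc Γ)) (uvar x)
translate-readGlobal (glob G) x x∈G = rGlob x∈G
translate-readGlobal (Γ ,, y) x x∈G = translate-weakenBy y (translate-readGlobal Γ x x∈G)

translate-readBound : ∀ Γ i → Γ ⊩ readBound (loc Γ) i ⇝ shifted (toℕ i) one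
translate-readBound (Γ ,, y) zero    = rHere
translate-readBound (Γ ,, y) (suc i) = translate-weakenBy y (translate-readBound Γ i)

translate-readback : ∀ Γ (t : Λ (len (loc Γ))) → (∀ x → x ∈ᵍ t → x ∈ globalsOf Γ) →
                     Γ ⊩ readback (loc Γ) t ⇝ ⌜ t ⌝
translate-readback Γ (gv x)   globals∈ = translate-readGlobal Γ x (globals∈ x here-gv)
translate-readback Γ (bv i)   globals∈ = translate-readBound Γ i
translate-readback Γ (ap a b) globals∈ =
  rApp (translate-readback Γ a (λ x → globals∈ x ∘ in-apˡ)) (translate-readback Γ b (λ x → globals∈ x ∘ in-apʳ))
translate-readback Γ (lm y a) globals∈ = rLam (translate-readback (Γ ,, y) a (λ x → globals∈ x ∘ in-lm))

readback-≡α : (c₁ c₂ : Λ 0) → c₁ ~ c₂ → readback ∙ c₁ ≡α readback ∙ c₂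
readback-≡α c₁ c₂ c₁~c₂ with FV-readback ∙ c₁ | FV-readback ∙ c₂
... | .(glob H₁) , FV≡₁ , globals {H = H₁} , vis₁ | .(glob H₂) , FV≡₂ , globals {H = H₂} , vis₂ =
  (H₁ ++ H₂ , translation-typing T₁) , (H₁ ++ H₂ , translation-typing T₂) ,
  H₁ , H₂ , FV≡₁ , FV≡₂ , ⌜ c₁ ⌝ , T₁ , subst (_ ⊩ _ ⇝_) (⌜⌝-~ (~sym c₁~c₂)) T₂
  where
  T₁ : glob (H₁ ++ H₂) ⊩ readback ∙ c₁ ⇝ ⌜ c₁ ⌝
  T₁ = translate-readback (glob (H₁ ++ H₂)) c₁ (λ x x∈ → ∈-++⁺ˡ (proj₁ (vis₁ x x∈)))
  T₂ : glob (H₁ ++ H₂) ⊩ readback ∙ c₂ ⇝ ⌜ c₂ ⌝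
  T₂ = translate-readback (glob (H₁ ++ H₂)) c₂ (λ x x∈ → ∈-++⁺ʳ H₁ (proj₁ (vis₂ x x∈)))

-- Both reductions are simulated by parallel reductions of the interpretations,
-- which start from ~-related terms; confluence of Λ joins them, and reading
-- the common reduct back (reachable in λα from B₁ and B₂ up to binder names)
-- yields α-equivalent terms.
mainTheorem2 : ∀ {A₁ A₂ B₁ B₂ : Tm} → Good A₁ → Good A₂ → A₁ ≡α A₂ →
    A₁ ↠ B₁ → A₂ ↠ B₂ →
    ∃[ C₁ ] ∃[ C₂ ] (B₁ ↠ C₁ × B₂ ↠ C₂ × C₁ ≡α C₂)
mainTheorem2 _ _ (_ , _ , _ , _ , _ , _ , _ , T₁ , T₂) A₁↠B₁ A₂↠B₂
  with steps-sim (translation-typing T₁) A₁↠B₁ | steps-sim (translation-typing T₂) A₂↠B₂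
... | d₁ , p₁ | d₂ , p₂
  with confluence p₁ (~→⇒ (same-translation-~ T₁ T₂) ◅ p₂)
... | c , q₁ , q₂
  with parallel-steps-sim ∙ (~refl _) q₁ | parallel-steps-sim ∙ (~refl _) q₂
... | c₁ , c₁~c , r₁ | c₂ , c₂~c , r₂ =
  readback ∙ c₁ , readback ∙ c₂ ,
  reduces-to-readback d₁ ◅◅ r₁ , reduces-to-readback d₂ ◅◅ r₂ ,
  readback-≡α c₁ c₂ (~trans c₁~c (~sym c₂~c))
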